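{- (i) The molecular graphs of methane, ethane and propane are $G_\phi$-graphs. (ii) The molecular graphs of butane and isobutane are $G_\phi$-graphs. (iii) The molecular graphs of pentane and isopentane are $G_\phi$-graphs.
   Context: $\phi$ denotes Euler's totient function, $\phi^0(n)=n$ and $\phi^i(n)=\phi(\phi^{i-1}(n))$. For a set $A$ of positive integers, $A_\phi=\{\phi^k(n): n\in A,\ k\ge 0\}$, and $G_\phi(A)$ is the simple graph with vertex set $A_\phi$ in which distinct vertices $r,s$ are adjacent iff $\phi(r)=s$ or $\phi(s)=r$. A graph $H$ is a $G_\phi$-graph if $H$ is isomorphic to $G_\phi(A)$ for some set $A$ of positive integers. Molecular graphs include all atoms (carbon and hydrogen) as vertices and bonds as edges; they are trees in which every carbon vertex has degree $4$ and every hydrogen vertex has degree $1$. Specifically: methane is $K_{1,4}$ (one carbon, four hydrogens); ethane has two adjacent carbons each with three hydrogen neighbours; propane has carbons forming a path $c_1c_2c_3$, with hydrogens filling degrees to $4$; butane has carbons forming a path $c_1c_2c_3c_4$, hydrogens filling degrees to $4$; isobutane has a central carbon adjacent to three other carbons and one hydrogen, each other carbon having three hydrogens; pentane has carbons forming a path $c_1\cdots c_5$, hydrogens filling degrees to $4$; isopentane (2-methylbutane) has carbons forming a path $c_1c_2c_3c_4$ plus a fifth carbon $c_5$ adjacent to $c_2$, hydrogens filling all carbon degrees to $4$. -}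

module Defs where

open import Data.Nat using (ℕ; zero; suc; _<_; _≟_)
open import Data.Nat.GCD using (gcd)
open import Data.List using (List; []; _∷_; length; filter; map; upTo)
open import Data.List.Membership.Propositional using (_∈_)
open import Data.List.Relation.Unary.All using (All)
open import Data.Fin using (Fin; toℕ)
open import Data.Product using (Σ; _×_; _,_; ∃; ∃-syntax)
open import Data.Sum using (_⊎_)
open import Relation.Nullary using (¬_)
open import Relation.Binary.PropositionalEquality using (_≡_; _≢_)
open import Function.Definitions using (Injective)
open import Function.Bundles using (_⇔_)

φ : ℕ → ℕ
φ n = length (filter (λ k → gcd k n ≟ 1) (map suc (upTo n)))

φ^ : ℕ → ℕ → ℕ
φ^ zero    n = n
φ^ (suc i) n = φ (φ^ i n)

_∈Aφ_ : ℕ → List ℕ → Set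
x ∈Aφ A = ∃[ n ] ∃[ k ] (n ∈ A × φ^ k n ≡ x)

-- adjacency in G_φ(A) (restricted to vertices of A_φ by the isomorphism below)
GφAdj : ℕ → ℕ → Set
GφAdj r s = r ≢ s × (φ r ≡ s ⊎ φ s ≡ r)

record Graph : Set₁ where
  field
    size : ℕ
    Adj  : Fin size → Fin size → Set
open Graph public

IsGφGraph : Graph → Set
IsGφGraph H =
  ∃[ A ] (All (0 <_) A ×
  ∃[ f ] (Injective _≡_ _≡_ f
        × (∀ i → f i ∈Aφ A)
        × (∀ x → x ∈Aφ A → ∃[ i ] f i ≡ x)
        × (∀ i j → Adj H i j ⇔ GφAdj (f i) (f j))))

EdgeGraph : ℕ → List (ℕ × ℕ) → Graph
EdgeGraph n E = record
  { size = n
  ; Adj  = λ i j → ((toℕ i , toℕ j) ∈ E) ⊎ ((toℕ j , toℕ i) ∈ E) }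

-- Molecular graphs. Carbons are numbered first, then hydrogens.

methane : Graph
methane = EdgeGraph 5 ((0 , 1) ∷ (0 , 2) ∷ (0 , 3) ∷ (0 , 4) ∷ [])

ethane : Graph
ethane = EdgeGraph 8
  ( (0 , 1)
  ∷ (0 , 2) ∷ (0 , 3) ∷ (0 , 4)
  ∷ (1 , 5) ∷ (1 , 6) ∷ (1 , 7) ∷ [])

propane : Graph
propane = EdgeGraph 11
  ( (0 , 1) ∷ (1 , 2)
  ∷ (0 , 3) ∷ (0 , 4) ∷ (0 , 5)
  ∷ (1 , 6) ∷ (1 , 7)
  ∷ (2 , 8) ∷ (2 , 9) ∷ (2 , 10) ∷ [])

butane : Graph
butane = EdgeGraph 14
  ( (0 , 1) ∷ (1 , 2) ∷ (2 , 3)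
  ∷ (0 , 4) ∷ (0 , 5) ∷ (0 , 6)
  ∷ (1 , 7) ∷ (1 , 8)
  ∷ (2 , 9) ∷ (2 , 10)
  ∷ (3 , 11) ∷ (3 , 12) ∷ (3 , 13) ∷ [])

isobutane : Graph
isobutane = EdgeGraph 14
  ( (0 , 1) ∷ (0 , 2) ∷ (0 , 3)
  ∷ (0 , 4)
  ∷ (1 , 5) ∷ (1 , 6) ∷ (1 , 7)
  ∷ (2 , 8) ∷ (2 , 9) ∷ (2 , 10)
  ∷ (3 , 11) ∷ (3 , 12) ∷ (3 , 13) ∷ [])

pentane : Graph
pentane = EdgeGraph 17
  ( (0 , 1) ∷ (1 , 2) ∷ (2 , 3) ∷ (3 , 4)
  ∷ (0 , 5) ∷ (0 , 6) ∷ (0 , 7)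
  ∷ (1 , 8) ∷ (1 , 9)
  ∷ (2 , 10) ∷ (2 , 11)
  ∷ (3 , 12) ∷ (3 , 13)
  ∷ (4 , 14) ∷ (4 , 15) ∷ (4 , 16) ∷ [])

isopentane : Graph
isopentane = EdgeGraph 17
  ( (0 , 1) ∷ (1 , 2) ∷ (2 , 3) ∷ (1 , 4)
  ∷ (0 , 5) ∷ (0 , 6) ∷ (0 , 7)
  ∷ (1 , 8)
  ∷ (2 , 9) ∷ (2 , 10)
  ∷ (3 , 11) ∷ (3 , 12) ∷ (3 , 13)
  ∷ (4 , 14) ∷ (4 , 15) ∷ (4 , 16) ∷ [])

-- Label the atoms injectively by positive integers so that every bond joins
-- some n to φ n: a carbon labelled n is adjacent to φ n and to preimages of n,
-- and hydrogens are labels with no preimage among the labels (e.g. methane is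
-- 2 with neighbours 1 = φ 2 and 3, 4, 6). Taking A to be the labels with no
-- preimage, A_φ is exactly the set of labels, and the remaining conditions are
-- finite and are checked by decision procedures.
module Submission where

open import Defs
open import Data.Nat using (ℕ; zero; suc; _<_; _<?_)
open import Data.Nat.Properties using (_≟_)
open import Data.Fin using (Fin; toℕ)
import Data.Fin.Properties as Fin
open import Data.Vec using (Vec; []; _∷_; lookup)
open import Data.List using (List; []; _∷_; upTo)
open import Data.List.Relation.Unary.All as All using (All)
open import Data.List.Relation.Unary.Any as Any using (Any)
open import Data.List.Membership.Propositional using (find)
open import Data.Product using (_×_; _,_; ∃-syntax)
open import Data.Product.Properties using (≡-dec)
open import Data.List.Membership.DecPropositional (≡-dec _≟_ _≟_) using (_∈?_)
open import Relation.Nullary using (Dec; ¬?)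
open import Relation.Nullary.Decidable using (True; toWitness; map′; _×-dec_; _⊎-dec_; _→-dec_)
open import Relation.Binary.PropositionalEquality using (_≡_; trans; cong)
open import Function.Bundles using (_⇔_; mk⇔; Equivalence)

_⇔-dec_ : {P Q : Set} → Dec P → Dec Q → Dec (P ⇔ Q)
p ⇔-dec q =
  map′ (λ (to , from) → mk⇔ to from) (λ e → Equivalence.to e , Equivalence.from e)
       ((p →-dec q) ×-dec (q →-dec p))

GφAdj? : ∀ r s → Dec (GφAdj r s)
GφAdj? r s = ¬? (r ≟ s) ×-dec ((φ r ≟ s) ⊎-dec (φ s ≟ r))

EdgeGraph-Adj? : ∀ n E (i j : Fin n) → Dec (Adj (EdgeGraph n E) i j)
EdgeGraph-Adj? n E i j = ((toℕ i , toℕ j) ∈? E) ⊎-dec ((toℕ j , toℕ i) ∈? E)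

_∈Aφ[<_]_ : ℕ → ℕ → List ℕ → Set
x ∈Aφ[< K ] A = Any (λ a → Any (λ k → φ^ k a ≡ x) (upTo K)) A

∈Aφ[<]? : ∀ x K A → Dec (x ∈Aφ[< K ] A)
∈Aφ[<]? x K A = Any.any? (λ a → Any.any? (λ k → φ^ k a ≟ x) (upTo K)) A

∈Aφ[<]⇒∈Aφ : ∀ {x K A} → x ∈Aφ[< K ] A → x ∈Aφ A
∈Aφ[<]⇒∈Aφ x∈ with find x∈
... | a , a∈A , k<K with find k<K
...   | k , _ , φ^ka≡x = a , k , a∈A , φ^ka≡x

φ^-closed : {B : Set} (f : B → ℕ) (a : ℕ) →
            (∃[ i ] f i ≡ a) → (∀ i → ∃[ j ] f j ≡ φ (f i)) →
            ∀ k → ∃[ i ] f i ≡ φ^ k a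
φ^-closed f a a∈f closed zero = a∈f
φ^-closed f a a∈f closed (suc k) with φ^-closed f a a∈f closed k
... | i , fi≡φ^ka with closed i
...   | j , fj≡φfi = j , trans fj≡φfi (cong φ fi≡φ^ka)

-- A certificate that `label` is an isomorphism H ≅ G_φ(A); the search bound K
-- only makes membership of A_φ decidable.
module _ (H : Graph) (A : List ℕ) (label : Fin (size H) → ℕ) (K : ℕ) where

  GφCertificate : Set
  GφCertificate =
      All (0 <_) A
    × (∀ i j → label i ≡ label j → i ≡ j)
    × (∀ i → label i ∈Aφ[< K ] A)
    × All (λ a → ∃[ i ] label i ≡ a) A
    × (∀ i → ∃[ j ] label j ≡ φ (label i))
    × (∀ i j → Adj H i j ⇔ GφAdj (label i) (label j))

  GφCertificate? : (∀ i j → Dec (Adj H i j)) → Dec GφCertificate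
  GφCertificate? Adj? =
        All.all? (0 <?_) A
    ×-dec Fin.all? (λ i → Fin.all? λ j → (label i ≟ label j) →-dec (i Fin.≟ j))
    ×-dec Fin.all? (λ i → ∈Aφ[<]? (label i) K A)
    ×-dec All.all? (λ a → Fin.any? λ i → label i ≟ a) A
    ×-dec Fin.all? (λ i → Fin.any? λ j → label j ≟ φ (label i))
    ×-dec Fin.all? (λ i → Fin.all? λ j → Adj? i j ⇔-dec GφAdj? (label i) (label j))

  GφCertificate⇒IsGφGraph : GφCertificate → IsGφGraph H
  GφCertificate⇒IsGφGraph (pos , inj , reach , seeds , closed , adj) =
    A , pos , label , (λ {i} {j} → inj i j) , (λ i → ∈Aφ[<]⇒∈Aφ (reach i)) , onto , adj
    where
    onto : ∀ x → x ∈Aφ A → ∃[ i ] label i ≡ x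
    onto x (a , k , a∈A , φ^ka≡x) with φ^-closed label a (All.lookup seeds a∈A) closed k
    ... | i , li≡φ^ka = i , trans li≡φ^ka φ^ka≡x

isGφGraph-byLabels : ∀ {n E} (A : List ℕ) (labels : Vec ℕ n) →
  {_ : True (GφCertificate? (EdgeGraph n E) A (lookup labels) 6 (EdgeGraph-Adj? n E))} →
  IsGφGraph (EdgeGraph n E)
isGφGraph-byLabels {n} {E} A labels {c} =
  GφCertificate⇒IsGφGraph (EdgeGraph n E) A (lookup labels) 6 (toWitness c)

methane-Gφ : IsGφGraph methane
methane-Gφ = isGφGraph-byLabels
  (3 ∷ 4 ∷ 6 ∷ [])
  (2 ∷ 1 ∷ 3 ∷ 4 ∷ 6 ∷ [])

ethane-Gφ : IsGφGraph ethane
ethane-Gφ = isGφGraph-byLabels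
  (3 ∷ 6 ∷ 5 ∷ 8 ∷ 10 ∷ [])
  (2 ∷ 4 ∷ 1 ∷ 3 ∷ 6 ∷ 5 ∷ 8 ∷ 10 ∷ [])

propane-Gφ : IsGφGraph propane
propane-Gφ = isGφGraph-byLabels
  (5 ∷ 8 ∷ 10 ∷ 3 ∷ 7 ∷ 9 ∷ 14 ∷ [])
  (4 ∷ 2 ∷ 6 ∷ 5 ∷ 8 ∷ 10 ∷ 1 ∷ 3 ∷ 7 ∷ 9 ∷ 14 ∷ [])

butane-Gφ : IsGφGraph butane
butane-Gφ = isGφGraph-byLabels
  (7 ∷ 9 ∷ 14 ∷ 3 ∷ 5 ∷ 10 ∷ 15 ∷ 16 ∷ 20 ∷ [])
  (6 ∷ 2 ∷ 4 ∷ 8 ∷ 7 ∷ 9 ∷ 14 ∷ 1 ∷ 3 ∷ 5 ∷ 10 ∷ 15 ∷ 16 ∷ 20 ∷ [])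

isobutane-Gφ : IsGφGraph isobutane
isobutane-Gφ = isGφGraph-byLabels
  (5 ∷ 3 ∷ 6 ∷ 15 ∷ 16 ∷ 20 ∷ 13 ∷ 21 ∷ 26 ∷ [])
  (4 ∷ 2 ∷ 8 ∷ 12 ∷ 5 ∷ 1 ∷ 3 ∷ 6 ∷ 15 ∷ 16 ∷ 20 ∷ 13 ∷ 21 ∷ 26 ∷ [])

pentane-Gφ : IsGφGraph pentane
pentane-Gφ = isGφGraph-byLabels
  (7 ∷ 9 ∷ 14 ∷ 3 ∷ 5 ∷ 10 ∷ 15 ∷ 20 ∷ 17 ∷ 32 ∷ 34 ∷ [])
  (6 ∷ 2 ∷ 4 ∷ 8 ∷ 16 ∷ 7 ∷ 9 ∷ 14 ∷ 1 ∷ 3 ∷ 5 ∷ 10 ∷ 15 ∷ 20 ∷ 17 ∷ 32 ∷ 34 ∷ [])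

isopentane-Gφ : IsGφGraph isopentane
isopentane-Gφ = isGφGraph-byLabels
  (15 ∷ 16 ∷ 20 ∷ 5 ∷ 3 ∷ 7 ∷ 9 ∷ 14 ∷ 13 ∷ 21 ∷ 26 ∷ [])
  (8 ∷ 4 ∷ 2 ∷ 6 ∷ 12 ∷ 15 ∷ 16 ∷ 20 ∷ 5 ∷ 1 ∷ 3 ∷ 7 ∷ 9 ∷ 14 ∷ 13 ∷ 21 ∷ 26 ∷ [])

theorem3p1 : (IsGφGraph methane × IsGφGraph ethane × IsGφGraph propane)
           × (IsGφGraph butane × IsGφGraph isobutane)
           × (IsGφGraph pentane × IsGφGraph isopentane)
theorem3p1 = (methane-Gφ , ethane-Gφ , propane-Gφ)
           , (butane-Gφ , isobutane-Gφ)
           , (pentane-Gφ , isopentane-Gφ)
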